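{- Let $h,k$ be positive integers with $\gcd(h,k)=1$ and let $u\neq0,1$ be a complex number. Then for all integers $n\ge0$, $$(hk)^{n}\sum_{a=0}^{k-1}\sum_{b=0}^{h-1}u^{hk-(kb+ha)}\,\overline{H}_{n}\!\left(\frac{a}{k}+\frac{b}{h},u^{hk}\right)=\left(u^{hk}-1\right)\frac{u}{u-1}H_{n}(u).$$
   Context: For $v\neq1$, the Frobenius–Euler numbers $H_n(v)$ and polynomials $H_n(x,v)$ are defined by $\frac{1-v}{e^{t}-v}=\sum_{n\ge0}H_n(v)\frac{t^n}{n!}$ and $\frac{1-v}{e^{t}-v}e^{xt}=\sum_{n\ge0}H_n(x,v)\frac{t^n}{n!}$. The Frobenius–Euler function $\overline{H}_n(x,v)$ for real $x$ is defined by $\overline{H}_n(x,v)=H_n(x,v)$ for $0\le x<1$ and $\overline{H}_n(x+1,v)=v\,\overline{H}_n(x,v)$. -}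

module Defs where

open import Level using (Level; _⊔_) renaming (suc to lsuc)
open import Algebra.Bundles using (CommutativeRing)
open import Data.Nat as ℕ using (ℕ; zero; suc; _≤?_)
open import Data.Nat.DivMod using (_/_; _%_)
open import Data.Nat.Combinatorics using (_C_)
open import Data.Integer as ℤ using (ℤ; +_; -[1+_])
open import Relation.Nullary using (¬_; yes; no)

record Field (c ℓ : Level) : Set (lsuc (c ⊔ ℓ)) where
  field
    commutativeRing : CommutativeRing c ℓ
  open CommutativeRing commutativeRing public
  field
    _⁻¹        : Carrier → Carrier
    ⁻¹-inverse : ∀ x → ¬ (x ≈ 0#) → x * (x ⁻¹) ≈ 1#
    0≉1        : ¬ (0# ≈ 1#)

module FieldDefs {c ℓ : Level} (F : Field c ℓ) where
  open Field F public

  infixl 6 _−_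
  _−_ : Carrier → Carrier → Carrier
  x − y = x + (- y)

  fromℕ : ℕ → Carrier
  fromℕ zero    = 0#
  fromℕ (suc n) = 1# + fromℕ n

  CharZero : Set ℓ
  CharZero = ∀ n → ¬ (fromℕ (suc n) ≈ 0#)

  pow : Carrier → ℕ → Carrier
  pow x zero    = 1#
  pow x (suc n) = x * pow x n

  zpow : Carrier → ℤ → Carrier
  zpow x (+ n)      = pow x n
  zpow x -[1+ n ]   = pow (x ⁻¹) (suc n)

  sumTo : ℕ → (ℕ → Carrier) → Carrier
  sumTo zero    f = 0#
  sumTo (suc n) f = sumTo n f + f n

  -- Frobenius–Euler numbers, via the coefficient recurrence of
  -- (1-v) = (e^t - v) Σ H_n(v) t^n/n! :
  --   H_0 = 1,  H_n = (v-1)⁻¹ Σ_{j<n} C(n,j) H_j  (n ≥ 1).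
  -- Hseq v m k = H_k(v) for k ≤ m.
  Hseq : Carrier → ℕ → ℕ → Carrier
  Hseq v zero    k = 1#
  Hseq v (suc m) k with k ≤? m
  ... | yes _ = Hseq v m k
  ... | no  _ = ((v − 1#) ⁻¹) * sumTo (suc m) (λ j → fromℕ (suc m C j) * Hseq v m j)

  H : ℕ → Carrier → Carrier
  H n v = Hseq v n n

  Hpoly : ℕ → Carrier → Carrier → Carrier
  Hpoly n x v = sumTo (suc n) (λ j → fromℕ (n C j) * H j v * pow x (n ℕ.∸ j))

  -- Frobenius–Euler function at a nonnegative rational x = p / d (d ≠ 0):
  --   H̄_n(x,v) = v^⌊x⌋ H_n({x}, v),
  -- which is the unique function with H̄_n = H_n on [0,1) and H̄_n(x+1) = v H̄_n(x).
  Hbar : ℕ → (p d : ℕ) → .{{_ : ℕ.NonZero d}} → Carrier → Carrier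
  Hbar n p d v = pow v (p / d) * Hpoly n (fromℕ (p % d) * (fromℕ d ⁻¹)) v

module Submission where

open import Defs
open import Data.Nat as ℕ using (ℕ; _<_)
open import Data.Nat.GCD using (gcd)
open import Data.Nat.Properties using (m*n≢0)
open import Data.Integer as ℤ using (+_)
open import Relation.Binary.PropositionalEquality using (_≡_)
open import Relation.Nullary using (¬_)

open import Data.Nat using (zero; suc; _≤_; _∸_; NonZero)
import Data.Nat.Properties as ℕP
open import Data.Nat.DivMod using (_/_; _%_)
import Data.Nat.DivMod as DivMod
open import Data.Nat.Combinatorics using (_C_; nCn≡1; k>n⇒nCk≡0; nCk+nC[k+1]≡[n+1]C[k+1])
open import Data.Nat.Coprimality using (Coprime; gcd≡1⇒coprime)
import Data.Integer.Properties as ℤP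
open import Data.Fin as Fin using (Fin; toℕ; fromℕ<)
open import Data.Fin.Permutation using (Permutation)
import Data.Fin.Properties as FinP
open import Data.Product using (_×_; _,_)
open import Data.Sum using (inj₁; inj₂)
open import Relation.Nullary using (yes; no; contradiction)
import Relation.Binary.PropositionalEquality as ≡

-- Put m = hk, v = u^m, M = m·1.  Every p = ha + kb (a < k, b < h)
-- lies in [0, 2m), so by quasi-periodicity of H̄ₙ each summand equals
-- g(p mod m) with g(r) = u^{m−r} Hₙ(r/M, v).  Since gcd(h,k) = 1, the map
-- (a,b) ↦ (ha + kb) mod m is a bijection [0,k)×[0,h) → [0,m) (Chinese
-- remainder theorem; surjectivity comes from injectivity by pigeonhole), so the
-- double sum is Σ_{r<m} g(r).  Reading sequences as exponential generating
-- functions, Mⁿ Σ_r g(r) is the n-th coefficient of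
--   (1 − v)/(e^{Mt} − v) · S(t),   S(t) = Σ_{r<m} u^{m−r} e^{rt},
-- and telescoping gives S(t)(eᵗ − u) = u(e^{Mt} − v).  Hence this product X
-- satisfies the Frobenius–Euler equation X·eᵗ = u·X + u(1 − v), as does
-- (v − 1)u/(u − 1) · H(u); its solutions are unique for u ≠ 1.

-- Residues modulo h, and the Chinese remainder map.
module Residues where
  open import Data.Nat using (_+_; _*_; _∸_; _<_; _≤_; NonZero)
  import Data.Nat.Properties as ℕP
  open import Data.Nat.DivMod using (_/_; _%_)
  import Data.Nat.DivMod as DivMod
  open import Data.Nat.Divisibility using (_∣_; divides; m∣m*n; n∣m*n; n∣m⇒m%n≡0)
  open import Data.Nat.Coprimality as Coprime using (Coprime; coprime-divisor)
  open import Data.Product using (_×_; _,_)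
  open import Data.Sum using (inj₁; inj₂)
  open import Relation.Binary.PropositionalEquality

  open ≡-Reasoning

  %-≡⇒∣∸ : ∀ x y d .{{_ : NonZero d}} → x % d ≡ y % d → d ∣ x ∸ y
  %-≡⇒∣∸ x y d eq = divides (x / d ∸ y / d) (begin
    x ∸ y                                       ≡⟨ cong₂ _∸_ (DivMod.m≡m%n+[m/n]*n x d) (DivMod.m≡m%n+[m/n]*n y d) ⟩
    (x % d + x / d * d) ∸ (y % d + y / d * d)   ≡⟨ cong (λ z → (x % d + x / d * d) ∸ (z + y / d * d)) (sym eq) ⟩
    (x % d + x / d * d) ∸ (x % d + y / d * d)   ≡⟨ ℕP.[m+n]∸[m+o]≡n∸o (x % d) _ _ ⟩
    x / d * d ∸ y / d * d                       ≡⟨ ℕP.*-distribʳ-∸ d (x / d) (y / d) ⟨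
    (x / d ∸ y / d) * d                         ∎)

  ∣∧<⇒≡0 : ∀ {t d} .{{_ : NonZero d}} → d ∣ t → t < d → t ≡ 0
  ∣∧<⇒≡0 {t} {d} d∣t t<d = trans (sym (DivMod.m<n⇒m%n≡m t<d)) (n∣m⇒m%n≡0 t d d∣t)

  coprime-cancel-≤ : ∀ {h k x y} .{{_ : NonZero h}} → Coprime h k → x < h → y ≤ x →
                     (k * x) % h ≡ (k * y) % h → x ≡ y
  coprime-cancel-≤ {h} {k} {x} {y} cop x<h y≤x eq = ℕP.≤-antisym (ℕP.m∸n≡0⇒m≤n x∸y≡0) y≤x
    where
    h∣x∸y : h ∣ x ∸ y
    h∣x∸y = coprime-divisor cop (subst (h ∣_) (sym (ℕP.*-distribˡ-∸ k x y)) (%-≡⇒∣∸ (k * x) (k * y) h eq))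
    x∸y≡0 : x ∸ y ≡ 0
    x∸y≡0 = ∣∧<⇒≡0 h∣x∸y (ℕP.≤-<-trans (ℕP.m∸n≤m x y) x<h)

  coprime-cancel : ∀ {h k x y} .{{_ : NonZero h}} → Coprime h k → x < h → y < h →
                   (k * x) % h ≡ (k * y) % h → x ≡ y
  coprime-cancel {x = x} {y} cop x<h y<h eq with ℕP.≤-total y x
  ... | inj₁ y≤x = coprime-cancel-≤ cop x<h y≤x eq
  ... | inj₂ x≤y = sym (coprime-cancel-≤ cop y<h x≤y (sym eq))

  reduce-mod : ∀ {d N} x y .{{_ : NonZero d}} .{{_ : NonZero N}} → d ∣ N → d ∣ x →
               (x + y) % N % d ≡ y % d
  reduce-mod {d} {N} x y d∣N d∣x =
    trans (DivMod.m∣n⇒o%n%m≡o%m d N (x + y) d∣N) (DivMod.%-remove-+ˡ y d∣x)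

  crt-injective : ∀ {h k a b a' b'} .{{_ : NonZero h}} .{{_ : NonZero k}} .{{_ : NonZero (h * k)}} →
                  Coprime h k → a < k → b < h → a' < k → b' < h →
                  (h * a + k * b) % (h * k) ≡ (h * a' + k * b') % (h * k) → a ≡ a' × b ≡ b'
  crt-injective {h} {k} {a} {b} {a'} {b'} cop a<k b<h a'<k b'<h eq =
    coprime-cancel (Coprime.sym cop) a<k a'<k mod-k , coprime-cancel cop b<h b'<h mod-h
    where
    mod-h : (k * b) % h ≡ (k * b') % h
    mod-h = begin
      (k * b) % h                     ≡⟨ reduce-mod (h * a) (k * b) (m∣m*n k) (m∣m*n a) ⟨
      (h * a + k * b) % (h * k) % h   ≡⟨ cong (_% h) eq ⟩
      (h * a' + k * b') % (h * k) % h ≡⟨ reduce-mod (h * a') (k * b') (m∣m*n k) (m∣m*n a') ⟩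
      (k * b') % h                    ∎
    swap : ∀ x y → (x + y) % (h * k) % k ≡ (y + x) % (h * k) % k
    swap x y = cong (λ z → z % (h * k) % k) (ℕP.+-comm x y)
    mod-k : (h * a) % k ≡ (h * a') % k
    mod-k = begin
      (h * a) % k                     ≡⟨ reduce-mod (k * b) (h * a) (n∣m*n h) (m∣m*n b) ⟨
      (k * b + h * a) % (h * k) % k   ≡⟨ swap (k * b) (h * a) ⟩
      (h * a + k * b) % (h * k) % k   ≡⟨ cong (λ z → z % k) eq ⟩
      (h * a' + k * b') % (h * k) % k ≡⟨ swap (h * a') (k * b') ⟩
      (k * b' + h * a') % (h * k) % k ≡⟨ reduce-mod (k * b') (h * a') (n∣m*n h) (m∣m*n b') ⟩
      (h * a') % k                    ∎

  [a*h+b]%h≡b : ∀ a b h .{{_ : NonZero h}} → b < h → (a * h + b) % h ≡ b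
  [a*h+b]%h≡b a b h b<h = begin
    (a * h + b) % h ≡⟨ cong (_% h) (ℕP.+-comm (a * h) b) ⟩
    (b + a * h) % h ≡⟨ DivMod.[m+kn]%n≡m%n b a h ⟩
    b % h           ≡⟨ DivMod.m<n⇒m%n≡m b<h ⟩
    b               ∎

  [a*h+b]/h≡a : ∀ a b h .{{_ : NonZero h}} → b < h → (a * h + b) / h ≡ a
  [a*h+b]/h≡a a b h b<h = begin
    (a * h + b) / h   ≡⟨ DivMod.+-distrib-/ (a * h) b no-carry ⟩
    a * h / h + b / h ≡⟨ cong₂ _+_ (DivMod.m*n/n≡m a h) (DivMod.m<n⇒m/n≡0 b<h) ⟩
    a + 0             ≡⟨ ℕP.+-identityʳ a ⟩
    a                 ∎
    where
    no-carry : (a * h) % h + b % h < h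
    no-carry = subst (_< h) (sym (cong₂ _+_ (DivMod.m*n%n≡0 a h) (DivMod.m<n⇒m%n≡m b<h))) b<h

module FinitePermutations where
  open import Data.Nat using (suc)
  import Data.Nat.Properties as ℕP
  open import Data.Fin using (Fin; punchOut)
  import Data.Fin.Properties as FinP
  open import Data.Fin.Permutation using (Permutation; permutation)
  open import Data.Product using (∃; _,_; proj₁; proj₂)
  open import Function.Definitions using (Injective)
  open import Relation.Nullary using (yes; no; contradiction)
  open import Relation.Binary.PropositionalEquality using (_≡_; sym)

  injective⇒surjective : ∀ {n} (f : Fin n → Fin n) → Injective _≡_ _≡_ f → ∀ y → ∃ λ x → f x ≡ y
  injective⇒surjective {suc n} f f-inj y with FinP.any? (λ x → f x FinP.≟ y)
  ... | yes found = found
  ... | no missed = contradiction (FinP.injective⇒≤ punched-inj) ℕP.1+n≰n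
    where
    -- without a preimage of y, f would inject Fin (suc n) into Fin n
    punched : Fin (suc n) → Fin n
    punched x = punchOut {i = y} (λ y≡fx → missed (x , sym y≡fx))
    punched-inj : Injective _≡_ _≡_ punched
    punched-inj {x} {x'} eq = f-inj (FinP.punchOut-injective {i = y}
      (λ y≡fx → missed (x , sym y≡fx)) (λ y≡fx' → missed (x' , sym y≡fx')) eq)

  injective⇒permutation : ∀ {n} (f : Fin n → Fin n) → Injective _≡_ _≡_ f → Permutation n n
  injective⇒permutation f f-inj = permutation f preimage
    (λ y → proj₂ (surj y)) (λ x → f-inj (proj₂ (surj (f x))))
    where
    surj : ∀ y → ∃ λ x → f x ≡ y
    surj = injective⇒surjective f f-inj
    preimage : Fin _ → Fin _
    preimage y = proj₁ (surj y)

module FrobeniusEuler {c ℓ} (F : Field c ℓ) where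
  open FieldDefs F
  open import Relation.Binary.Reasoning.Setoid setoid
  open import Algebra.Solver.Ring.NaturalCoefficients.Default commutativeSemiring
    using (solve; _:+_; _:*_; _:=_)
  open import Algebra.Properties.Ring ring using (-1*x≈-x; -‿distribʳ-*)
  open import Algebra.Properties.AbelianGroup +-abelianGroup using (⁻¹-anti-homo‿-)
  open import Algebra.Properties.Group +-group using (∙-cancelʳ; x∙y⁻¹≈ε⇒x≈y)
  import Algebra.Properties.CommutativeMonoid.Sum +-commutativeMonoid as FinSum

  inverseˡ : ∀ {a} → ¬ a ≈ 0# → a ⁻¹ * a ≈ 1#
  inverseˡ {a} a≉0 = trans (*-comm _ _) (⁻¹-inverse a a≉0)

  x−1≉0 : ∀ {x} → ¬ x ≈ 1# → ¬ x − 1# ≈ 0#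
  x−1≉0 {x} x≉1 x−1≈0 = x≉1 (x∙y⁻¹≈ε⇒x≈y x 1# x−1≈0)

  *-cancelˡ-≉0 : ∀ {a x y} → ¬ a ≈ 0# → a * x ≈ a * y → x ≈ y
  *-cancelˡ-≉0 {a} {x} {y} a≉0 eq = begin
    x               ≈⟨ undo x ⟨
    a ⁻¹ * (a * x)  ≈⟨ *-congˡ eq ⟩
    a ⁻¹ * (a * y)  ≈⟨ undo y ⟩
    y               ∎
    where
    undo : ∀ z → a ⁻¹ * (a * z) ≈ z
    undo z = trans (sym (*-assoc _ _ _)) (trans (*-congʳ (inverseˡ a≉0)) (*-identityˡ z))

  [w−1]x+x≈wx : ∀ w x → (w − 1#) * x + x ≈ w * x
  [w−1]x+x≈wx w x = begin
    (w − 1#) * x + x         ≈⟨ +-congʳ (distribʳ x w (- 1#)) ⟩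
    (w * x + - 1# * x) + x   ≈⟨ +-assoc _ _ _ ⟩
    w * x + (- 1# * x + x)   ≈⟨ +-congˡ (+-congʳ (-1*x≈-x x)) ⟩
    w * x + (- x + x)        ≈⟨ +-congˡ (-‿inverseˡ x) ⟩
    w * x + 0#               ≈⟨ +-identityʳ _ ⟩
    w * x                    ∎

  affine-unique : ∀ {w p e e' x y} → ¬ w ≈ 1# →
                  p + x ≈ w * x + e → p + y ≈ w * y + e' → e ≈ e' → x ≈ y
  affine-unique {w} {p} {e} {e'} {x} {y} w≉1 eqx eqy e≈e' =
    *-cancelˡ-≉0 (x−1≉0 w≉1)
      (∙-cancelʳ e _ _ (trans (solved eqx) (trans (sym (solved eqy)) (+-congˡ (sym e≈e')))))
    where
    solved : ∀ {z f} → p + z ≈ w * z + f → (w − 1#) * z + f ≈ p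
    solved {z} {f} eq = ∙-cancelʳ z _ _ (begin
      ((w − 1#) * z + f) + z  ≈⟨ swap ((w − 1#) * z) f z ⟩
      ((w − 1#) * z + z) + f  ≈⟨ +-congʳ ([w−1]x+x≈wx w z) ⟩
      w * z + f               ≈⟨ eq ⟨
      p + z                   ∎)
      where
      swap : ∀ a b d → (a + b) + d ≈ (a + d) + b
      swap = solve 3 (λ a b d → (a :+ b) :+ d := (a :+ d) :+ b) refl

  pow-cong : ∀ r {x y} → x ≈ y → pow x r ≈ pow y r
  pow-cong zero    x≈y = refl
  pow-cong (suc r) x≈y = *-cong x≈y (pow-cong r x≈y)

  pow-+ : ∀ x a b → pow x (a ℕ.+ b) ≈ pow x a * pow x b
  pow-+ x zero    b = sym (*-identityˡ _)
  pow-+ x (suc a) b = trans (*-congˡ (pow-+ x a b)) (sym (*-assoc _ _ _))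

  pow-* : ∀ x y n → pow x n * pow y n ≈ pow (x * y) n
  pow-* x y zero    = *-identityˡ _
  pow-* x y (suc n) = trans (interchange _ _ _ _) (*-congˡ (pow-* x y n))
    where
    interchange : ∀ x y a b → (x * a) * (y * b) ≈ (x * y) * (a * b)
    interchange = solve 4 (λ x y a b → (x :* a) :* (y :* b) := (x :* y) :* (a :* b)) refl

  pow-1# : ∀ n → pow 1# n ≈ 1#
  pow-1# zero    = refl
  pow-1# (suc n) = trans (*-identityˡ _) (pow-1# n)

  pow-inverse : ∀ {u} r → ¬ u ≈ 0# → pow (u ⁻¹) r * pow u r ≈ 1#
  pow-inverse {u} r u≉0 = trans (pow-* _ _ r) (trans (pow-cong r (inverseˡ u≉0)) (pow-1# r))

  fromℕ-+ : ∀ a b → fromℕ (a ℕ.+ b) ≈ fromℕ a + fromℕ b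
  fromℕ-+ zero    b = sym (+-identityˡ _)
  fromℕ-+ (suc a) b = trans (+-congˡ (fromℕ-+ a b)) (sym (+-assoc _ _ _))

  fromℕ-≉0 : CharZero → ∀ {m} → 0 < m → ¬ fromℕ m ≈ 0#
  fromℕ-≉0 χ {suc m} _ = χ m

  -- Sequences of field elements; below they are read as the coefficient
  -- sequences (Xₙ) of exponential generating functions Σ Xₙ tⁿ/n!.
  Seq : Set c
  Seq = ℕ → Carrier

  sum-cong< : ∀ n {f g : Seq} → (∀ i → i < n → f i ≈ g i) → sumTo n f ≈ sumTo n g
  sum-cong< zero    eq = refl
  sum-cong< (suc n) eq = +-cong (sum-cong< n (λ i i<n → eq i (ℕP.m<n⇒m<1+n i<n))) (eq n ℕP.≤-refl)

  sum-cong : ∀ n {f g : Seq} → (∀ i → f i ≈ g i) → sumTo n f ≈ sumTo n g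
  sum-cong n eq = sum-cong< n (λ i _ → eq i)

  sum-0 : ∀ n {f : Seq} → (∀ i → i < n → f i ≈ 0#) → sumTo n f ≈ 0#
  sum-0 zero    eq = refl
  sum-0 (suc n) eq = trans (+-cong (sum-0 n (λ i i<n → eq i (ℕP.m<n⇒m<1+n i<n))) (eq n ℕP.≤-refl)) (+-identityʳ 0#)

  sum-+ : ∀ n (f g : Seq) → sumTo n (λ i → f i + g i) ≈ sumTo n f + sumTo n g
  sum-+ zero    f g = sym (+-identityʳ 0#)
  sum-+ (suc n) f g = trans (+-congʳ (sum-+ n f g)) (interchange _ _ _ _)
    where
    interchange : ∀ a b x y → (a + b) + (x + y) ≈ (a + x) + (b + y)
    interchange = solve 4 (λ a b x y → (a :+ b) :+ (x :+ y) := (a :+ x) :+ (b :+ y)) refl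

  sum-*ˡ : ∀ n k (f : Seq) → sumTo n (λ i → k * f i) ≈ k * sumTo n f
  sum-*ˡ zero    k f = sym (zeroʳ k)
  sum-*ˡ (suc n) k f = trans (+-congʳ (sum-*ˡ n k f)) (sym (distribˡ k _ _))

  sum-head : ∀ n (f : Seq) → sumTo (suc n) f ≈ f 0 + sumTo n (λ i → f (suc i))
  sum-head zero    f = trans (+-identityˡ (f 0)) (sym (+-identityʳ (f 0)))
  sum-head (suc n) f = trans (+-congʳ (sum-head n f)) (+-assoc _ _ _)

  sum-split : ∀ p q (f : Seq) → sumTo (p ℕ.+ q) f ≈ sumTo p f + sumTo q (λ i → f (p ℕ.+ i))
  sum-split p zero    f rewrite ℕP.+-identityʳ p = sym (+-identityʳ _)
  sum-split p (suc q) f rewrite ℕP.+-suc p q = trans (+-congʳ (sum-split p q f)) (+-assoc _ _ _)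

  telescope : ∀ n (f : Seq) → sumTo n (λ i → f (suc i)) + f 0 ≈ sumTo n f + f n
  telescope zero    f = refl
  telescope (suc n) f = begin
    (sumTo n (λ i → f (suc i)) + f (suc n)) + f 0  ≈⟨ swap _ _ _ ⟩
    (sumTo n (λ i → f (suc i)) + f 0) + f (suc n)  ≈⟨ +-congʳ (telescope n f) ⟩
    (sumTo n f + f n) + f (suc n)                  ∎
    where
    swap : ∀ a b d → (a + b) + d ≈ (a + d) + b
    swap = solve 3 (λ a b d → (a :+ b) :+ d := (a :+ d) :+ b) refl

  flatten : ∀ k h (G : Seq) → sumTo k (λ a → sumTo h (λ b → G (a ℕ.* h ℕ.+ b))) ≈ sumTo (k ℕ.* h) G
  flatten zero    h G = refl
  flatten (suc k) h G = begin
    sumTo k (λ a → sumTo h (λ b → G (a ℕ.* h ℕ.+ b))) + sumTo h (λ b → G (k ℕ.* h ℕ.+ b))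
      ≈⟨ +-congʳ (flatten k h G) ⟩
    sumTo (k ℕ.* h) G + sumTo h (λ b → G (k ℕ.* h ℕ.+ b))  ≈⟨ sum-split (k ℕ.* h) h G ⟨
    sumTo (k ℕ.* h ℕ.+ h) G                                ≡⟨ ≡.cong (λ N → sumTo N G) (ℕP.+-comm (k ℕ.* h) h) ⟩
    sumTo (suc k ℕ.* h) G                                  ∎

  -- sumTo agrees with the library's summation over Fin n, which is
  -- invariant under permutations.
  sumTo≈sum : ∀ n (f : Seq) → sumTo n f ≈ FinSum.sum {n} (λ i → f (toℕ i))
  sumTo≈sum zero    f = refl
  sumTo≈sum (suc n) f = begin
    sumTo n f + f n                                   ≈⟨ +-cong (sumTo≈sum n f) (reflexive (≡.cong f (≡.sym (FinP.toℕ-fromℕ n)))) ⟩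
    FinSum.sum {n} (λ i → f (toℕ i)) + f (toℕ last)   ≡⟨ ≡.cong (_+ f (toℕ last)) (FinSum.sum-cong-≗ {n} (λ i → ≡.cong f (≡.sym (FinP.toℕ-inject₁ i)))) ⟩
    FinSum.sum {n} (λ i → f (toℕ (Fin.inject₁ i))) + f (toℕ last) ≈⟨ FinSum.sum-init-last {n} (λ i → f (toℕ i)) ⟨
    FinSum.sum {suc n} (λ i → f (toℕ i))              ∎
    where
    last : Fin (suc n)
    last = Fin.fromℕ n

  sum-reindex : ∀ N (ρ : ℕ → ℕ) → (∀ i → i < N → ρ i < N) →
                (∀ i j → i < N → j < N → ρ i ≡ ρ j → i ≡ j) →
                ∀ (g : Seq) → sumTo N (λ i → g (ρ i)) ≈ sumTo N g
  sum-reindex N ρ ρ<N ρ-inj g = begin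
    sumTo N (λ i → g (ρ i))                     ≈⟨ sumTo≈sum N (λ i → g (ρ i)) ⟩
    FinSum.sum {N} (λ i → g (ρ (toℕ i)))        ≡⟨ FinSum.sum-cong-≗ {N} (λ i → ≡.cong g (≡.sym (FinP.toℕ-fromℕ< _))) ⟩
    FinSum.sum {N} (λ i → g (toℕ (ρ̂ i)))        ≈⟨ FinSum.sum-permute (λ i → g (toℕ i)) π ⟨
    FinSum.sum {N} (λ i → g (toℕ i))            ≈⟨ sumTo≈sum N g ⟨
    sumTo N g                                   ∎
    where
    ρ̂ : Fin N → Fin N
    ρ̂ i = fromℕ< (ρ<N (toℕ i) (FinP.toℕ<n i))
    ρ̂-inj : ∀ {i j} → ρ̂ i ≡ ρ̂ j → i ≡ j
    ρ̂-inj {i} {j} eq = FinP.toℕ-injective (ρ-inj (toℕ i) (toℕ j) (FinP.toℕ<n i) (FinP.toℕ<n j)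
      (≡.trans (≡.sym (FinP.toℕ-fromℕ< _)) (≡.trans (≡.cong toℕ eq) (FinP.toℕ-fromℕ< _))))
    π : Permutation N N
    π = FinitePermutations.injective⇒permutation ρ̂ ρ̂-inj

  sum-reindex₂ : ∀ k h .{{_ : NonZero h}} (φ : ℕ → ℕ → ℕ) →
                 (∀ a b → a < k → b < h → φ a b < k ℕ.* h) →
                 (∀ {a b a' b'} → a < k → b < h → a' < k → b' < h → φ a b ≡ φ a' b' → a ≡ a' × b ≡ b') →
                 ∀ (g : Seq) → sumTo k (λ a → sumTo h (λ b → g (φ a b))) ≈ sumTo (k ℕ.* h) g
  sum-reindex₂ k h φ φ< φ-inj g = begin
    sumTo k (λ a → sumTo h (λ b → g (φ a b)))             ≈⟨ sum-cong k (λ a → sum-cong< h (λ b b<h → reflexive (≡.cong g (≡.sym (ρ-digits a b<h))))) ⟩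
    sumTo k (λ a → sumTo h (λ b → g (ρ (a ℕ.* h ℕ.+ b)))) ≈⟨ flatten k h (λ i → g (ρ i)) ⟩
    sumTo (k ℕ.* h) (λ i → g (ρ i))                       ≈⟨ sum-reindex (k ℕ.* h) ρ ρ<kh ρ-inj g ⟩
    sumTo (k ℕ.* h) g                                     ∎
    where
    open Residues using ([a*h+b]/h≡a; [a*h+b]%h≡b)
    ρ : ℕ → ℕ
    ρ i = φ (i / h) (i % h)
    ρ-digits : ∀ a {b} → b < h → ρ (a ℕ.* h ℕ.+ b) ≡ φ a b
    ρ-digits a {b} b<h = ≡.cong₂ φ ([a*h+b]/h≡a a b h b<h) ([a*h+b]%h≡b a b h b<h)
    quot< : ∀ {i} → i < k ℕ.* h → i / h < k
    quot< = DivMod.m<n*o⇒m/o<n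
    ρ<kh : ∀ i → i < k ℕ.* h → ρ i < k ℕ.* h
    ρ<kh i i<kh = φ< _ _ (quot< i<kh) (DivMod.m%n<n i h)
    ρ-inj : ∀ i j → i < k ℕ.* h → j < k ℕ.* h → ρ i ≡ ρ j → i ≡ j
    ρ-inj i j i<kh j<kh eq with φ-inj (quot< i<kh) (DivMod.m%n<n i h) (quot< j<kh) (DivMod.m%n<n j h) eq
    ... | quot≡ , rem≡ = ≡.trans (DivMod.m≡m%n+[m/n]*n i h)
      (≡.trans (≡.cong₂ (λ r q → r ℕ.+ q ℕ.* h) rem≡ quot≡) (≡.sym (DivMod.m≡m%n+[m/n]*n j h)))

  -- Binomial convolution: the coefficients of the product of two exponential
  -- generating functions,  (A ⋆ B)ₙ = Σ_{j≤n} C(n,j) Aⱼ B_{n−j}.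
  -- The sequence  pow x  is e^{xt}; Hpoly n x v is by definition (H(v) ⋆ pow x)ₙ.
  infixl 7 _⋆_
  _⋆_ : Seq → Seq → Seq
  (A ⋆ B) n = sumTo (suc n) (λ j → fromℕ (n C j) * A j * B (n ∸ j))

  -- The derivative d/dt, the unit 1, and the substitution t ↦ M·t.
  shift : Seq → Seq
  shift A n = A (suc n)

  δ : Seq
  δ zero    = 1#
  δ (suc _) = 0#

  scale : Carrier → Seq → Seq
  scale M A n = pow M n * A n

  ⋆-cong : ∀ {A A' B B' : Seq} → (∀ i → A i ≈ A' i) → (∀ i → B i ≈ B' i) → ∀ n → (A ⋆ B) n ≈ (A' ⋆ B') n
  ⋆-cong eA eB n = sum-cong (suc n) (λ j → *-cong (*-congˡ (eA j)) (eB (n ∸ j)))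

  ⋆-at-0 : ∀ A B → (A ⋆ B) 0 ≈ A 0 * B 0
  ⋆-at-0 A B = begin
    0# + (1# + 0#) * A 0 * B 0 ≈⟨ +-identityˡ _ ⟩
    (1# + 0#) * A 0 * B 0      ≈⟨ *-congʳ (*-congʳ (+-identityʳ 1#)) ⟩
    1# * A 0 * B 0             ≈⟨ *-congʳ (*-identityˡ _) ⟩
    A 0 * B 0                  ∎

  ⋆-last : ∀ A B n → (A ⋆ B) n ≈ sumTo n (λ j → fromℕ (n C j) * A j * B (n ∸ j)) + A n * B 0
  ⋆-last A B n = +-congˡ (begin
    fromℕ (n C n) * A n * B (n ∸ n) ≈⟨ *-congʳ (*-congʳ (reflexive (≡.cong fromℕ (nCn≡1 n)))) ⟩
    fromℕ 1 * A n * B (n ∸ n)       ≈⟨ *-congʳ (*-congʳ (+-identityʳ 1#)) ⟩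
    1# * A n * B (n ∸ n)            ≡⟨ ≡.cong (λ i → 1# * A n * B i) (ℕP.n∸n≡0 n) ⟩
    1# * A n * B 0                  ≈⟨ *-congʳ (*-identityˡ _) ⟩
    A n * B 0                       ∎)

  -- Leibniz rule (AB)' = A'B + AB', coefficientwise; it follows from Pascal's rule.
  leibniz : ∀ A B n → (A ⋆ B) (suc n) ≈ (shift A ⋆ B) n + (A ⋆ shift B) n
  leibniz A B n = begin
    (A ⋆ B) (suc n)                                ≈⟨ sum-head (suc n) T ⟩
    T 0 + sumTo (suc n) (λ j → T (suc j))          ≈⟨ +-congˡ (sum-cong (suc n) pascal) ⟩
    T 0 + sumTo (suc n) (λ j → P j + Q j)          ≈⟨ +-congˡ (sum-+ (suc n) P Q) ⟩
    T 0 + (sumTo (suc n) P + (sumTo n Q + Q n))    ≈⟨ +-congˡ (+-congˡ (trans (+-congˡ Qn≈0) (+-identityʳ _))) ⟩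
    T 0 + (sumTo (suc n) P + sumTo n Q)            ≈⟨ swap _ _ _ ⟩
    sumTo (suc n) P + (T 0 + sumTo n Q)            ≈⟨ +-congˡ (+-congˡ (sum-cong< n R≈Q)) ⟨
    sumTo (suc n) P + (R 0 + sumTo n (λ j → R (suc j))) ≈⟨ +-congˡ (sum-head n R) ⟨
    (shift A ⋆ B) n + (A ⋆ shift B) n              ∎
    where
    T P Q R : Seq
    T j = fromℕ (suc n C j) * A j * B (suc n ∸ j)
    P j = fromℕ (n C j) * A (suc j) * B (n ∸ j)
    Q j = fromℕ (n C suc j) * A (suc j) * B (n ∸ j)
    R j = fromℕ (n C j) * A j * B (suc (n ∸ j))
    pascal : ∀ j → T (suc j) ≈ P j + Q j
    pascal j = begin
      fromℕ (suc n C suc j) * A (suc j) * B (n ∸ j)                ≡⟨ ≡.cong (λ c → fromℕ c * A (suc j) * B (n ∸ j)) (≡.sym (nCk+nC[k+1]≡[n+1]C[k+1] n j)) ⟩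
      fromℕ (n C j ℕ.+ n C suc j) * A (suc j) * B (n ∸ j)          ≈⟨ *-congʳ (*-congʳ (fromℕ-+ (n C j) (n C suc j))) ⟩
      (fromℕ (n C j) + fromℕ (n C suc j)) * A (suc j) * B (n ∸ j)  ≈⟨ expand _ _ _ _ ⟩
      P j + Q j                                                    ∎
      where
      expand : ∀ a b x y → (a + b) * x * y ≈ a * x * y + b * x * y
      expand = solve 4 (λ a b x y → (a :+ b) :* x :* y := a :* x :* y :+ b :* x :* y) refl
    Qn≈0 : Q n ≈ 0#
    Qn≈0 = begin
      fromℕ (n C suc n) * A (suc n) * B (n ∸ n) ≡⟨ ≡.cong (λ c → fromℕ c * A (suc n) * B (n ∸ n)) (k>n⇒nCk≡0 (ℕP.n<1+n n)) ⟩
      0# * A (suc n) * B (n ∸ n)                ≈⟨ trans (*-congʳ (zeroˡ _)) (zeroˡ _) ⟩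
      0#                                        ∎
    R≈Q : ∀ j → j < n → R (suc j) ≈ Q j
    R≈Q j j<n = reflexive (≡.cong (λ i → fromℕ (n C suc j) * A (suc j) * B i) (≡.sym (ℕP.+-∸-assoc 1 j<n)))
    swap : ∀ a b x → a + (b + x) ≈ b + (a + x)
    swap = solve 3 (λ a b x → a :+ (b :+ x) := b :+ (a :+ x)) refl

  ⋆-+ˡ : ∀ (A A' B : Seq) n → ((λ i → A i + A' i) ⋆ B) n ≈ (A ⋆ B) n + (A' ⋆ B) n
  ⋆-+ˡ A A' B n = trans (sum-cong (suc n) (λ j → expand _ _ _ _)) (sum-+ (suc n) _ _)
    where
    expand : ∀ k a a' b → k * (a + a') * b ≈ k * a * b + k * a' * b
    expand = solve 4 (λ k a a' b → k :* (a :+ a') :* b := k :* a :* b :+ k :* a' :* b) refl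

  ⋆-+ʳ : ∀ (A B B' : Seq) n → (A ⋆ (λ i → B i + B' i)) n ≈ (A ⋆ B) n + (A ⋆ B') n
  ⋆-+ʳ A B B' n = trans (sum-cong (suc n) (λ j → distribˡ _ _ _)) (sum-+ (suc n) _ _)

  ⋆-*ˡ : ∀ k (A B : Seq) n → ((λ i → k * A i) ⋆ B) n ≈ k * (A ⋆ B) n
  ⋆-*ˡ k A B n = trans (sum-cong (suc n) (λ j → pull _ _ _ _)) (sum-*ˡ (suc n) k _)
    where
    pull : ∀ k c a b → c * (k * a) * b ≈ k * (c * a * b)
    pull = solve 4 (λ k c a b → c :* (k :* a) :* b := k :* (c :* a :* b)) refl

  ⋆-*ʳ : ∀ k (A B : Seq) n → (A ⋆ (λ i → k * B i)) n ≈ k * (A ⋆ B) n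
  ⋆-*ʳ k A B n = trans (sum-cong (suc n) (λ j → pull _ _ _)) (sum-*ˡ (suc n) k _)
    where
    pull : ∀ k a b → a * (k * b) ≈ k * (a * b)
    pull = solve 3 (λ k a b → a :* (k :* b) := k :* (a :* b)) refl

  ⋆-0ʳ : ∀ (A : Seq) n → (A ⋆ (λ _ → 0#)) n ≈ 0#
  ⋆-0ʳ A n = sum-0 (suc n) (λ j _ → zeroʳ _)

  ⋆-sumʳ : ∀ N (A : Seq) (w : ℕ → Carrier) (B : ℕ → Seq) n →
           (A ⋆ (λ i → sumTo N (λ r → w r * B r i))) n ≈ sumTo N (λ r → w r * (A ⋆ B r) n)
  ⋆-sumʳ zero    A w B n = ⋆-0ʳ A n
  ⋆-sumʳ (suc N) A w B n = begin
    (A ⋆ (λ i → sumTo N (λ r → w r * B r i) + w N * B N i)) n         ≈⟨ ⋆-+ʳ A (λ i → sumTo N (λ r → w r * B r i)) (λ i → w N * B N i) n ⟩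
    (A ⋆ (λ i → sumTo N (λ r → w r * B r i))) n + (A ⋆ (λ i → w N * B N i)) n ≈⟨ +-cong (⋆-sumʳ N A w B n) (⋆-*ʳ (w N) A (B N) n) ⟩
    sumTo N (λ r → w r * (A ⋆ B r) n) + w N * (A ⋆ B N) n             ∎

  ⋆-comm : ∀ n (A B : Seq) → (A ⋆ B) n ≈ (B ⋆ A) n
  ⋆-comm zero    A B = trans (⋆-at-0 A B) (trans (*-comm _ _) (sym (⋆-at-0 B A)))
  ⋆-comm (suc n) A B = begin
    (A ⋆ B) (suc n)                          ≈⟨ leibniz A B n ⟩
    (shift A ⋆ B) n + (A ⋆ shift B) n        ≈⟨ +-cong (⋆-comm n (shift A) B) (⋆-comm n A (shift B)) ⟩
    (B ⋆ shift A) n + (shift B ⋆ A) n        ≈⟨ +-comm _ _ ⟩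
    (shift B ⋆ A) n + (B ⋆ shift A) n        ≈⟨ leibniz B A n ⟨
    (B ⋆ A) (suc n)                          ∎

  ⋆-assoc : ∀ n (A B D : Seq) → ((A ⋆ B) ⋆ D) n ≈ (A ⋆ (B ⋆ D)) n
  ⋆-assoc zero A B D = begin
    ((A ⋆ B) ⋆ D) 0      ≈⟨ trans (⋆-at-0 (A ⋆ B) D) (*-congʳ (⋆-at-0 A B)) ⟩
    A 0 * B 0 * D 0      ≈⟨ *-assoc _ _ _ ⟩
    A 0 * (B 0 * D 0)    ≈⟨ trans (⋆-at-0 A (B ⋆ D)) (*-congˡ (⋆-at-0 B D)) ⟨
    (A ⋆ (B ⋆ D)) 0      ∎
  ⋆-assoc (suc n) A B D = begin
    ((A ⋆ B) ⋆ D) (suc n)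
      ≈⟨ leibniz (A ⋆ B) D n ⟩
    (shift (A ⋆ B) ⋆ D) n + ((A ⋆ B) ⋆ shift D) n
      ≈⟨ +-congʳ (⋆-cong {B = D} (leibniz A B) (λ _ → refl) n) ⟩
    ((λ i → (shift A ⋆ B) i + (A ⋆ shift B) i) ⋆ D) n + ((A ⋆ B) ⋆ shift D) n
      ≈⟨ +-congʳ (⋆-+ˡ (shift A ⋆ B) (A ⋆ shift B) D n) ⟩
    (((shift A ⋆ B) ⋆ D) n + ((A ⋆ shift B) ⋆ D) n) + ((A ⋆ B) ⋆ shift D) n
      ≈⟨ +-cong (+-cong (⋆-assoc n (shift A) B D) (⋆-assoc n A (shift B) D)) (⋆-assoc n A B (shift D)) ⟩
    ((shift A ⋆ (B ⋆ D)) n + (A ⋆ (shift B ⋆ D)) n) + (A ⋆ (B ⋆ shift D)) n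
      ≈⟨ +-assoc _ _ _ ⟩
    (shift A ⋆ (B ⋆ D)) n + ((A ⋆ (shift B ⋆ D)) n + (A ⋆ (B ⋆ shift D)) n)
      ≈⟨ +-congˡ (⋆-+ʳ A (shift B ⋆ D) (B ⋆ shift D) n) ⟨
    (shift A ⋆ (B ⋆ D)) n + (A ⋆ (λ i → (shift B ⋆ D) i + (B ⋆ shift D) i)) n
      ≈⟨ +-congˡ (⋆-cong {A = A} (λ _ → refl) (leibniz B D) n) ⟨
    (shift A ⋆ (B ⋆ D)) n + (A ⋆ shift (B ⋆ D)) n
      ≈⟨ leibniz A (B ⋆ D) n ⟨
    (A ⋆ (B ⋆ D)) (suc n) ∎

  ⋆-δʳ : ∀ n (X : Seq) → (X ⋆ δ) n ≈ X n
  ⋆-δʳ zero    X = trans (⋆-at-0 X δ) (*-identityʳ _)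
  ⋆-δʳ (suc n) X = begin
    (X ⋆ δ) (suc n)                      ≈⟨ leibniz X δ n ⟩
    (shift X ⋆ δ) n + (X ⋆ shift δ) n    ≈⟨ +-cong (⋆-δʳ n (shift X)) (⋆-0ʳ X n) ⟩
    X (suc n) + 0#                       ≈⟨ +-identityʳ _ ⟩
    X (suc n)                            ∎

  pow-⋆-pow : ∀ x y n → (pow x ⋆ pow y) n ≈ pow (x + y) n
  pow-⋆-pow x y zero    = trans (⋆-at-0 (pow x) (pow y)) (*-identityʳ _)
  pow-⋆-pow x y (suc n) = begin
    (pow x ⋆ pow y) (suc n)                              ≈⟨ leibniz (pow x) (pow y) n ⟩
    (shift (pow x) ⋆ pow y) n + (pow x ⋆ shift (pow y)) n ≈⟨ +-cong (⋆-*ˡ x (pow x) (pow y) n) (⋆-*ʳ y (pow x) (pow y) n) ⟩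
    x * (pow x ⋆ pow y) n + y * (pow x ⋆ pow y) n        ≈⟨ distribʳ _ _ _ ⟨
    (x + y) * (pow x ⋆ pow y) n                          ≈⟨ *-congˡ (pow-⋆-pow x y n) ⟩
    pow (x + y) (suc n)                                  ∎

  scale-⋆ : ∀ M n (A B : Seq) → pow M n * (A ⋆ B) n ≈ (scale M A ⋆ scale M B) n
  scale-⋆ M n A B = trans (sym (sum-*ˡ (suc n) (pow M n) _)) (sum-cong< (suc n) termwise)
    where
    termwise : ∀ j → j < suc n →
               pow M n * (fromℕ (n C j) * A j * B (n ∸ j)) ≈ fromℕ (n C j) * scale M A j * scale M B (n ∸ j)
    termwise j j<1+n = begin
      pow M n * (fromℕ (n C j) * A j * B (n ∸ j))
        ≡⟨ ≡.cong (λ i → pow M i * (fromℕ (n C j) * A j * B (n ∸ j))) (≡.sym (ℕP.m+[n∸m]≡n (ℕ.s≤s⁻¹ j<1+n))) ⟩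
      pow M (j ℕ.+ (n ∸ j)) * (fromℕ (n C j) * A j * B (n ∸ j))
        ≈⟨ *-congʳ (pow-+ M j (n ∸ j)) ⟩
      (pow M j * pow M (n ∸ j)) * (fromℕ (n C j) * A j * B (n ∸ j))
        ≈⟨ regroup _ _ _ _ _ ⟩
      fromℕ (n C j) * (pow M j * A j) * (pow M (n ∸ j) * B (n ∸ j)) ∎
      where
      regroup : ∀ p q c a b → (p * q) * (c * a * b) ≈ c * (p * a) * (q * b)
      regroup = solve 5 (λ p q c a b → (p :* q) :* (c :* a :* b) := c :* (p :* a) :* (q :* b)) refl

  scale-⋆-pow : ∀ M x n (A : Seq) → pow M n * (A ⋆ pow x) n ≈ (scale M A ⋆ pow (M * x)) n
  scale-⋆-pow M x n A = trans (scale-⋆ M n A (pow x)) (⋆-cong (λ _ → refl) (pow-* M x) n)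

  pow-0# : ∀ n → pow 0# n ≈ δ n
  pow-0# zero    = refl
  pow-0# (suc n) = zeroˡ _

  scale-δ : ∀ M n → scale M δ n ≈ δ n
  scale-δ M zero    = *-identityˡ _
  scale-δ M (suc n) = zeroʳ _

  Hs : Carrier → Seq
  Hs v j = H j v

  H-unfold : ∀ v m → H (suc m) v ≡ ((v − 1#) ⁻¹) * sumTo (suc m) (λ j → fromℕ (suc m C j) * Hseq v m j)
  H-unfold v m with suc m ℕ.≤? m
  ... | yes 1+m≤m = contradiction 1+m≤m ℕP.1+n≰n
  ... | no  _     = ≡.refl

  Hseq-stable : ∀ v m j → j ≤ m → Hseq v m j ≡ H j v
  Hseq-stable v zero    zero ℕ.z≤n = ≡.refl
  Hseq-stable v (suc m) j j≤1+m with j ℕ.≤? m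
  ... | yes j≤m = Hseq-stable v m j j≤m
  ... | no  j≰m with ℕP.≤-antisym j≤1+m (ℕP.≰⇒> j≰m)
  ...   | ≡.refl = ≡.sym (H-unfold v m)

  -- X solves the Frobenius–Euler equation with parameters (w, c) when,
  -- as exponential generating functions,  X(t)·eᵗ = w·X(t) + c.
  -- H(v) solves it with (v, 1 − v), since (1 − v)/(eᵗ − v) is its generating function.
  SolvesFE : Carrier → Carrier → Seq → Set ℓ
  SolvesFE w c X = ∀ n → (X ⋆ pow 1#) n ≈ w * X n + c * δ n

  lower : Seq → Seq
  lower X n = sumTo n (λ j → fromℕ (n C j) * X j * pow 1# (n ∸ j))

  ⋆-pow1-last : ∀ X n → (X ⋆ pow 1#) n ≈ lower X n + X n
  ⋆-pow1-last X n = trans (⋆-last X (pow 1#) n) (+-congˡ (*-identityʳ (X n)))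

  H-solves : ∀ {v} → ¬ v ≈ 1# → SolvesFE v (1# − v) (Hs v)
  H-solves {v} v≉1 zero = begin
    (Hs v ⋆ pow 1#) 0          ≈⟨ trans (⋆-at-0 (Hs v) (pow 1#)) (*-identityʳ 1#) ⟩
    1#                         ≈⟨ v+[1−v]≈1 ⟨
    v + (1# − v)               ≈⟨ +-cong (*-identityʳ v) (*-identityʳ _) ⟨
    v * 1# + (1# − v) * 1#     ∎
    where
    v+[1−v]≈1 : v + (1# − v) ≈ 1#
    v+[1−v]≈1 = trans (+-comm v _) (trans (+-assoc _ _ _) (trans (+-congˡ (-‿inverseˡ v)) (+-identityʳ 1#)))
  H-solves {v} v≉1 (suc m) = begin
    (Hs v ⋆ pow 1#) (suc m)                ≈⟨ ⋆-pow1-last (Hs v) (suc m) ⟩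
    lower (Hs v) (suc m) + Hₘ₊₁            ≈⟨ +-congʳ (sum-cong< (suc m) stage) ⟩
    Σstage + Hₘ₊₁                          ≈⟨ +-congʳ recurrence ⟨
    (v − 1#) * Hₘ₊₁ + Hₘ₊₁                 ≈⟨ [w−1]x+x≈wx v Hₘ₊₁ ⟩
    v * Hₘ₊₁                               ≈⟨ trans (+-congˡ (zeroʳ _)) (+-identityʳ _) ⟨
    v * Hₘ₊₁ + (1# − v) * δ (suc m)        ∎
    where
    Hₘ₊₁ : Carrier
    Hₘ₊₁ = H (suc m) v
    Σstage : Carrier
    Σstage = sumTo (suc m) (λ j → fromℕ (suc m C j) * Hseq v m j)
    stage : ∀ j → j < suc m → fromℕ (suc m C j) * H j v * pow 1# (suc m ∸ j) ≈ fromℕ (suc m C j) * Hseq v m j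
    stage j j<1+m = trans (*-congˡ (pow-1# (suc m ∸ j)))
      (trans (*-identityʳ _) (*-congˡ (reflexive (≡.sym (Hseq-stable v m j (ℕ.s≤s⁻¹ j<1+m))))))
    recurrence : (v − 1#) * Hₘ₊₁ ≈ Σstage
    recurrence = begin
      (v − 1#) * Hₘ₊₁                        ≡⟨ ≡.cong ((v − 1#) *_) (H-unfold v m) ⟩
      (v − 1#) * ((v − 1#) ⁻¹ * Σstage)      ≈⟨ *-assoc _ _ _ ⟨
      ((v − 1#) * (v − 1#) ⁻¹) * Σstage      ≈⟨ *-congʳ (⁻¹-inverse _ (x−1≉0 v≉1)) ⟩
      1# * Σstage                            ≈⟨ *-identityˡ _ ⟩
      Σstage                                 ∎

  -- Solutions of the Frobenius–Euler equation are unique when w ≠ 1: the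
  -- coefficientwise equation determines Xₙ from X₀ … X_{n−1}.
  FE-unique : ∀ {w c c' X Y} → ¬ w ≈ 1# → SolvesFE w c X → SolvesFE w c' Y → c ≈ c' → ∀ n → X n ≈ Y n
  FE-unique {w} {c} {c'} {X} {Y} w≉1 solX solY c≈c' n = agree-below (suc n) n ℕP.≤-refl
    where
    agree-below : ∀ n j → j < n → X j ≈ Y j
    agree-below (suc n) j j<1+n with ℕP.m≤n⇒m<n∨m≡n (ℕ.s≤s⁻¹ j<1+n)
    ... | inj₁ j<n   = agree-below n j j<n
    ... | inj₂ ≡.refl = affine-unique w≉1
      (trans (sym (⋆-pow1-last X j)) (solX j))
      (trans (+-congʳ (sum-cong< j (λ i i<j → *-congʳ (*-congˡ (agree-below j i i<j)))))
             (trans (sym (⋆-pow1-last Y j)) (solY j)))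
      (*-congʳ c≈c')

  FE-*ˡ : ∀ {w c X} k → SolvesFE w c X → SolvesFE w (k * c) (λ i → k * X i)
  FE-*ˡ {w} {c} {X} k solX n = begin
    ((λ i → k * X i) ⋆ pow 1#) n    ≈⟨ ⋆-*ˡ k X (pow 1#) n ⟩
    k * (X ⋆ pow 1#) n              ≈⟨ *-congˡ (solX n) ⟩
    k * (w * X n + c * δ n)         ≈⟨ rearrange _ _ _ _ _ ⟩
    w * (k * X n) + (k * c) * δ n   ∎
    where
    rearrange : ∀ k w x c d → k * (w * x + c * d) ≈ w * (k * x) + (k * c) * d
    rearrange = solve 5 (λ k w x c d → k :* (w :* x :+ c :* d) := w :* (k :* x) :+ (k :* c) :* d) refl

  scale-solves : ∀ {w c X} M → SolvesFE w c X → ∀ n → (scale M X ⋆ pow M) n ≈ w * scale M X n + c * δ n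
  scale-solves {w} {c} {X} M solX n = begin
    (scale M X ⋆ pow M) n                    ≈⟨ ⋆-cong (λ _ → refl) (λ i → pow-cong i (*-identityʳ M)) n ⟨
    (scale M X ⋆ pow (M * 1#)) n             ≈⟨ scale-⋆-pow M 1# n X ⟨
    pow M n * (X ⋆ pow 1#) n                 ≈⟨ *-congˡ (solX n) ⟩
    pow M n * (w * X n + c * δ n)            ≈⟨ distribute _ _ _ _ _ ⟩
    w * scale M X n + c * scale M δ n        ≈⟨ +-congˡ (*-congˡ (scale-δ M n)) ⟩
    w * scale M X n + c * δ n                ∎
    where
    distribute : ∀ p w x c d → p * (w * x + c * d) ≈ w * (p * x) + c * (p * d)
    distribute = solve 5 (λ p w x c d → p :* (w :* x :+ c :* d) := w :* (p :* x) :+ c :* (p :* d)) refl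

  twisted : ℕ → Carrier → Seq
  twisted m u i = sumTo m (λ r → pow u (m ∸ r) * pow (fromℕ r) i)

  twisted-shift : ∀ m u n → (twisted m u ⋆ pow 1#) n + (u * pow u m) * δ n ≈ u * twisted m u n + u * pow (fromℕ m) n
  twisted-shift m u n = begin
    (twisted m u ⋆ pow 1#) n + (u * pow u m) * δ n
      ≈⟨ +-cong (⋆-comm n (twisted m u) (pow 1#)) (*-congˡ (sym (pow-0# n))) ⟩
    (pow 1# ⋆ twisted m u) n + f 0
      ≈⟨ +-congʳ (⋆-sumʳ m (pow 1#) (λ r → pow u (m ∸ r)) (λ r → pow (fromℕ r)) n) ⟩
    sumTo m (λ r → pow u (m ∸ r) * (pow 1# ⋆ pow (fromℕ r)) n) + f 0
      ≈⟨ +-congʳ (sum-cong< m shifted) ⟩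
    sumTo m (λ r → f (suc r)) + f 0
      ≈⟨ telescope m f ⟩
    sumTo m f + f m
      ≈⟨ +-cong (sum-cong m (λ r → *-assoc _ _ _)) last ⟩
    sumTo m (λ r → u * (pow u (m ∸ r) * pow (fromℕ r) n)) + u * pow (fromℕ m) n
      ≈⟨ +-congʳ (sum-*ˡ m u _) ⟩
    u * twisted m u n + u * pow (fromℕ m) n ∎
    where
    f : Seq
    f r = pow u (suc (m ∸ r)) * pow (fromℕ r) n
    -- e^{t}·e^{rt} = e^{(r+1)t}, and u^{m−r} = u^{1+(m−(r+1))}
    shifted : ∀ r → r < m → pow u (m ∸ r) * (pow 1# ⋆ pow (fromℕ r)) n ≈ f (suc r)
    shifted r r<m = trans (*-congˡ (pow-⋆-pow 1# (fromℕ r) n))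
      (reflexive (≡.cong (λ e → pow u e * pow (fromℕ (suc r)) n) (ℕP.+-∸-assoc 1 r<m)))
    last : f m ≈ u * pow (fromℕ m) n
    last = begin
      pow u (suc (m ∸ m)) * pow (fromℕ m) n ≡⟨ ≡.cong (λ e → pow u (suc e) * pow (fromℕ m) n) (ℕP.n∸n≡0 m) ⟩
      (u * 1#) * pow (fromℕ m) n            ≈⟨ *-congʳ (*-identityʳ u) ⟩
      u * pow (fromℕ m) n                   ∎

  -- With v = u^m and M = m, the product H(v)(Mt)·S(t) has
  -- generating function  (1 − v)/(e^{Mt} − v) · S(t) = u(1 − v)/(eᵗ − u), i.e. it
  -- solves the Frobenius–Euler equation with parameters (u, u(1 − v)).
  twisted-solves : ∀ m u → ¬ pow u m ≈ 1# → SolvesFE u (u * (1# − pow u m)) (scale (fromℕ m) (Hs (pow u m)) ⋆ twisted m u)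
  twisted-solves m u v≉1 n = ∙-cancelʳ ((u * v) * σH n) _ _ (begin
    (L ⋆ pow 1#) n + (u * v) * σH n
      ≈⟨ +-cong (⋆-assoc n σH S (pow 1#)) (*-congˡ (sym (⋆-δʳ n σH))) ⟩
    (σH ⋆ (S ⋆ pow 1#)) n + (u * v) * (σH ⋆ δ) n
      ≈⟨ +-congˡ (⋆-*ʳ (u * v) σH δ n) ⟨
    (σH ⋆ (S ⋆ pow 1#)) n + (σH ⋆ (λ i → (u * v) * δ i)) n
      ≈⟨ ⋆-+ʳ σH (S ⋆ pow 1#) (λ i → (u * v) * δ i) n ⟨
    (σH ⋆ (λ i → (S ⋆ pow 1#) i + (u * v) * δ i)) n
      ≈⟨ ⋆-cong (λ _ → refl) (twisted-shift m u) n ⟩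
    (σH ⋆ (λ i → u * S i + u * pow M i)) n
      ≈⟨ ⋆-+ʳ σH (λ i → u * S i) (λ i → u * pow M i) n ⟩
    (σH ⋆ (λ i → u * S i)) n + (σH ⋆ (λ i → u * pow M i)) n
      ≈⟨ +-cong (⋆-*ʳ u σH S n) (⋆-*ʳ u σH (pow M) n) ⟩
    u * L n + u * (σH ⋆ pow M) n
      ≈⟨ +-congˡ (*-congˡ (scale-solves M (H-solves v≉1) n)) ⟩
    u * L n + u * (v * σH n + (1# − v) * δ n)
      ≈⟨ regroup _ _ _ _ _ _ ⟩
    (u * L n + (u * (1# − v)) * δ n) + (u * v) * σH n ∎)
    where
    v M : Carrier
    v = pow u m
    M = fromℕ m
    σH S L : Seq
    σH = scale M (Hs v)
    S = twisted m u
    L = σH ⋆ S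
    regroup : ∀ u L v s a d → u * L + u * (v * s + a * d) ≈ (u * L + (u * a) * d) + (u * v) * s
    regroup = solve 6 (λ u L v s a d → u :* L :+ u :* (v :* s :+ a :* d) := (u :* L :+ (u :* a) :* d) :+ (u :* v) :* s) refl

  -- Since K·H(u) solves the same equation, with K = (v − 1)·u/(u − 1),
  -- uniqueness identifies the two.
  twisted-closed-form : ∀ m u → ¬ u ≈ 1# → ¬ pow u m ≈ 1# → ∀ n →
    (scale (fromℕ m) (Hs (pow u m)) ⋆ twisted m u) n ≈ (pow u m − 1#) * (u * ((u − 1#) ⁻¹)) * H n u
  twisted-closed-form m u u≉1 v≉1 =
    FE-unique u≉1 (twisted-solves m u v≉1) (FE-*ˡ K (H-solves u≉1)) constants
    where
    v K : Carrier
    v = pow u m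
    K = (v − 1#) * (u * ((u − 1#) ⁻¹))
    K[u−1]≈u[v−1] : K * (u − 1#) ≈ u * (v − 1#)
    K[u−1]≈u[v−1] = begin
      ((v − 1#) * (u * (u − 1#) ⁻¹)) * (u − 1#)   ≈⟨ regroup _ _ _ _ ⟩
      (u * (v − 1#)) * ((u − 1#) ⁻¹ * (u − 1#))   ≈⟨ *-congˡ (inverseˡ (x−1≉0 u≉1)) ⟩
      (u * (v − 1#)) * 1#                         ≈⟨ *-identityʳ _ ⟩
      u * (v − 1#)                                ∎
      where
      regroup : ∀ a b c d → (a * (b * c)) * d ≈ (b * a) * (c * d)
      regroup = solve 4 (λ a b c d → (a :* (b :* c)) :* d := (b :* a) :* (c :* d)) refl
    constants : u * (1# − v) ≈ K * (1# − u)
    constants = begin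
      u * (1# − v)        ≈⟨ *-congˡ (⁻¹-anti-homo‿- v 1#) ⟨
      u * - (v − 1#)      ≈⟨ -‿distribʳ-* u _ ⟨
      - (u * (v − 1#))    ≈⟨ -‿cong K[u−1]≈u[v−1] ⟨
      - (K * (u − 1#))    ≈⟨ -‿distribʳ-* K _ ⟩
      K * - (u − 1#)      ≈⟨ *-congˡ (⁻¹-anti-homo‿- u 1#) ⟩
      K * (1# − u)        ∎

  zpow-neg : ∀ u r → zpow u (ℤ.- (+ r)) ≡ pow (u ⁻¹) r
  zpow-neg u zero    = ≡.refl
  zpow-neg u (suc r) = ≡.refl

  weight : ∀ m .{{_ : NonZero m}} {u} → ¬ u ≈ 0# → ∀ p → p < m ℕ.+ m →
           zpow u (+ m ℤ.- + p) * pow (pow u m) (p / m) ≈ pow u (m ∸ p % m)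
  weight m {u} u≉0 p p<2m with ℕP.<-≤-connex p m
  ... | inj₁ p<m = begin
    zpow u (+ m ℤ.- + p) * pow (pow u m) (p / m)
      ≡⟨ ≡.cong₂ (λ e q → zpow u e * pow (pow u m) q) (≡.trans (ℤP.m-n≡m⊖n m p) (ℤP.⊖-≥ (ℕP.<⇒≤ p<m))) (DivMod.m<n⇒m/n≡0 p<m) ⟩
    pow u (m ∸ p) * 1#     ≈⟨ *-identityʳ _ ⟩
    pow u (m ∸ p)          ≡⟨ ≡.cong (λ q → pow u (m ∸ q)) (DivMod.m<n⇒m%n≡m p<m) ⟨
    pow u (m ∸ p % m)      ∎
  ... | inj₂ m≤p = begin
    zpow u (+ m ℤ.- + p) * pow (pow u m) (p / m)
      ≡⟨ ≡.cong₂ (λ e q → zpow u e * pow (pow u m) q) (≡.trans (ℤP.m-n≡m⊖n m p) (ℤP.⊖-≤ m≤p)) p/m≡1 ⟩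
    zpow u (ℤ.- (+ r)) * (pow u m * 1#)          ≈⟨ *-cong (reflexive (zpow-neg u r)) (*-identityʳ _) ⟩
    pow (u ⁻¹) r * pow u m                       ≈⟨ *-congˡ (trans (reflexive (≡.cong (pow u) (≡.sym (ℕP.m∸n+n≡m (ℕP.<⇒≤ r<m))))) (pow-+ u (m ∸ r) r)) ⟩
    pow (u ⁻¹) r * (pow u (m ∸ r) * pow u r)     ≈⟨ swap _ _ _ ⟩
    pow u (m ∸ r) * (pow (u ⁻¹) r * pow u r)     ≈⟨ *-congˡ (pow-inverse r u≉0) ⟩
    pow u (m ∸ r) * 1#                           ≈⟨ *-identityʳ _ ⟩
    pow u (m ∸ r)                                ≡⟨ ≡.cong (λ q → pow u (m ∸ q)) p%m≡r ⟨
    pow u (m ∸ p % m)                            ∎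
    where
    r : ℕ
    r = p ∸ m
    r<m : r < m
    r<m = ℕP.+-cancelʳ-< m r m (≡.subst (_< m ℕ.+ m) (≡.sym (ℕP.m∸n+n≡m m≤p)) p<2m)
    p/m≡1 : p / m ≡ 1
    p/m≡1 = ≡.trans (DivMod.m/n≡1+[m∸n]/n m≤p) (≡.cong suc (DivMod.m<n⇒m/n≡0 r<m))
    p%m≡r : p % m ≡ r
    p%m≡r = ≡.trans (≡.sym (DivMod.m≤n⇒[n∸m]%m≡n%m m≤p)) (DivMod.m<n⇒m%n≡m r<m)
    swap : ∀ a b c → a * (b * c) ≈ b * (a * c)
    swap = solve 3 (λ a b c → a :* (b :* c) := b :* (a :* c)) refl

  reduced : ℕ → Carrier → ℕ → ℕ → Carrier
  reduced m u n r = pow u (m ∸ r) * Hpoly n (fromℕ r * (fromℕ m ⁻¹)) (pow u m)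

  Hbar-weighted : ∀ m .{{_ : NonZero m}} {u} → ¬ u ≈ 0# → ∀ n p → p < m ℕ.+ m →
    zpow u (+ m ℤ.- + p) * Hbar n p m (pow u m) ≈ reduced m u n (p % m)
  Hbar-weighted m u≉0 n p p<2m =
    trans (sym (*-assoc _ _ _)) (*-congʳ (weight m u≉0 p p<2m))

  crt-summand : ∀ h k .{{_ : NonZero h}} .{{_ : NonZero k}} .{{_ : NonZero (h ℕ.* k)}} {u} → ¬ u ≈ 0# →
    ∀ n {a b} → a < k → b < h →
    zpow u (+ (h ℕ.* k) ℤ.- + (k ℕ.* b ℕ.+ h ℕ.* a)) * Hbar n (h ℕ.* a ℕ.+ k ℕ.* b) (h ℕ.* k) (pow u (h ℕ.* k))
      ≈ reduced (h ℕ.* k) u n ((h ℕ.* a ℕ.+ k ℕ.* b) % (h ℕ.* k))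
  crt-summand h k {u} u≉0 n {a} {b} a<k b<h = begin
    zpow u (+ m ℤ.- + (k ℕ.* b ℕ.+ h ℕ.* a)) * Hbar n p m (pow u m)
      ≡⟨ ≡.cong (λ q → zpow u (+ m ℤ.- + q) * Hbar n p m (pow u m)) (ℕP.+-comm (k ℕ.* b) (h ℕ.* a)) ⟩
    zpow u (+ m ℤ.- + p) * Hbar n p m (pow u m)
      ≈⟨ Hbar-weighted m u≉0 n p p<2m ⟩
    reduced m u n (p % m) ∎
    where
    m p : ℕ
    m = h ℕ.* k
    p = h ℕ.* a ℕ.+ k ℕ.* b
    p<2m : p < m ℕ.+ m
    p<2m = ℕP.+-mono-< (ℕP.*-monoʳ-< h a<k) (≡.subst (k ℕ.* b <_) (ℕP.*-comm k h) (ℕP.*-monoʳ-< k b<h))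

  scaled-Hpoly-sum : ∀ N M (w : ℕ → Carrier) v n → ¬ M ≈ 0# →
    pow M n * sumTo N (λ r → w r * Hpoly n (fromℕ r * (M ⁻¹)) v)
      ≈ (scale M (Hs v) ⋆ (λ i → sumTo N (λ r → w r * pow (fromℕ r) i))) n
  scaled-Hpoly-sum N M w v n M≉0 = begin
    pow M n * sumTo N (λ r → w r * Hpoly n (x r) v)          ≈⟨ sum-*ˡ N (pow M n) _ ⟨
    sumTo N (λ r → pow M n * (w r * (Hs v ⋆ pow (x r)) n))   ≈⟨ sum-cong N (λ r → swap _ _ _) ⟩
    sumTo N (λ r → w r * (pow M n * (Hs v ⋆ pow (x r)) n))   ≈⟨ sum-cong N (λ r → *-congˡ (scale-⋆-pow M (x r) n (Hs v))) ⟩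
    sumTo N (λ r → w r * (σH ⋆ pow (M * x r)) n)             ≈⟨ sum-cong N (λ r → *-congˡ (⋆-cong (λ _ → refl) (λ i → pow-cong i (M[r/M]≈r r)) n)) ⟩
    sumTo N (λ r → w r * (σH ⋆ pow (fromℕ r)) n)             ≈⟨ ⋆-sumʳ N σH w (λ r → pow (fromℕ r)) n ⟨
    (σH ⋆ (λ i → sumTo N (λ r → w r * pow (fromℕ r) i))) n   ∎
    where
    σH : Seq
    σH = scale M (Hs v)
    x : ℕ → Carrier
    x r = fromℕ r * (M ⁻¹)
    swap : ∀ a b c → a * (b * c) ≈ b * (a * c)
    swap = solve 3 (λ a b c → a :* (b :* c) := b :* (a :* c)) refl
    M[r/M]≈r : ∀ r → M * x r ≈ fromℕ r
    M[r/M]≈r r = trans (swap _ _ _) (trans (*-congˡ (⁻¹-inverse M M≉0)) (*-identityʳ _))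

  crt-reindex : ∀ h k .{{_ : NonZero h}} .{{_ : NonZero k}} .{{_ : NonZero (h ℕ.* k)}} → Coprime h k → ∀ (g : Seq) →
    sumTo k (λ a → sumTo h (λ b → g ((h ℕ.* a ℕ.+ k ℕ.* b) % (h ℕ.* k)))) ≈ sumTo (h ℕ.* k) g
  crt-reindex h k cop g = begin
    sumTo k (λ a → sumTo h (λ b → g (crt a b))) ≈⟨ sum-reindex₂ k h crt crt<kh (Residues.crt-injective cop) g ⟩
    sumTo (k ℕ.* h) g                           ≡⟨ ≡.cong (λ N → sumTo N g) (ℕP.*-comm k h) ⟩
    sumTo (h ℕ.* k) g                           ∎
    where
    crt : ℕ → ℕ → ℕ
    crt a b = (h ℕ.* a ℕ.+ k ℕ.* b) % (h ℕ.* k)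
    crt<kh : ∀ a b → a < k → b < h → crt a b < k ℕ.* h
    crt<kh a b _ _ = ≡.subst (crt a b <_) (ℕP.*-comm h k) (DivMod.m%n<n _ (h ℕ.* k))

lemma2p8 : ∀ {c ℓ} (F : Field c ℓ) → let open FieldDefs F in
    CharZero →
    (h k : ℕ) → (hpos : 0 < h) → (kpos : 0 < k) → gcd h k ≡ 1 →
    (u : Carrier) → ¬ (u ≈ 0#) → ¬ (u ≈ 1#) → ¬ (pow u (h ℕ.* k) ≈ 1#) →
    (n : ℕ) →
    pow (fromℕ (h ℕ.* k)) n
      * sumTo k (λ a → sumTo h (λ b →
          zpow u (+ (h ℕ.* k) ℤ.- + (k ℕ.* b ℕ.+ h ℕ.* a))
            * Hbar n (h ℕ.* a ℕ.+ k ℕ.* b) (h ℕ.* k) {{m*n≢0 h k {{ℕ.>-nonZero hpos}} {{ℕ.>-nonZero kpos}}}} (pow u (h ℕ.* k))))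
      ≈ (pow u (h ℕ.* k) − 1#) * (u * ((u − 1#) ⁻¹)) * H n u
lemma2p8 F χ h k hpos kpos gcd≡1 u u≉0 u≉1 v≉1 n = begin
  pow M n * sumTo k (λ a → sumTo h (λ b → zpow u (+ m ℤ.- + (k ℕ.* b ℕ.+ h ℕ.* a)) * Hbar n (h ℕ.* a ℕ.+ k ℕ.* b) m v))
    ≈⟨ *-congˡ (sum-cong< k (λ a a<k → sum-cong< h (λ b b<h → crt-summand h k u≉0 n a<k b<h))) ⟩
  pow M n * sumTo k (λ a → sumTo h (λ b → reduced m u n ((h ℕ.* a ℕ.+ k ℕ.* b) % m)))
    ≈⟨ *-congˡ (crt-reindex h k (gcd≡1⇒coprime gcd≡1) (reduced m u n)) ⟩
  pow M n * sumTo m (reduced m u n)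
    ≈⟨ scaled-Hpoly-sum m M (λ r → pow u (m ∸ r)) v n (fromℕ-≉0 χ (ℕ.>-nonZero⁻¹ m)) ⟩
  (scale M (Hs v) ⋆ twisted m u) n
    ≈⟨ twisted-closed-form m u u≉1 v≉1 n ⟩
  (v − 1#) * (u * (u − 1#) ⁻¹) * H n u ∎
  where
  open FieldDefs F
  open FrobeniusEuler F
  open import Relation.Binary.Reasoning.Setoid setoid
  instance
    h≢0 : NonZero h
    h≢0 = ℕ.>-nonZero hpos
    k≢0 : NonZero k
    k≢0 = ℕ.>-nonZero kpos
    hk≢0 : NonZero (h ℕ.* k)
    hk≢0 = m*n≢0 h k
  m : ℕ
  m = h ℕ.* k
  v M : Carrier
  v = pow u m
  M = fromℕ m
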